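{- Let $S\in\{0,1\}^\infty$. (1) If $\mathrm{Dim}_{FS}(S)=0$, then $S$ is finite-state shallow. (2) If $S$ is normal (i.e., $\dim_{FS}(S)=1$), then $S$ is finite-state shallow.
   Context: A finite-state transducer (FST) $T=(Q,\delta,\nu,q_0)$ has finite nonempty state set $Q$, $\delta:Q\times\{0,1\}\to Q$, $\nu:Q\times\{0,1\}\to\{0,1\}^*$, initial state $q_0$, all states reachable; with $\widehat\delta(\lambda)=q_0$, $\widehat\delta(xa)=\delta(\widehat\delta(x),a)$, its output is $T(\lambda)=\lambda$, $T(xa)=T(x)\nu(\widehat\delta(x),a)$. Fix a standard binary encoding of FSTs, $|T|$ its length, $\mathrm{FST}^{\le k}=\{T:|T|\le k\}$, and $D^k_{FS}(x)=\min\{|p|:\exists T\in\mathrm{FST}^{\le k},T(p)=x\}$. $S\upharpoonright n$ is the first $n$ bits of $S$. $\dim_{FS}(S)=\lim_{k\to\infty}\liminf_{n\to\infty}D^k_{FS}(S\upharpoonright n)/n$ and $\mathrm{Dim}_{FS}(S)=\lim_{k\to\infty}\limsup_{n\to\infty}D^k_{FS}(S\upharpoonright n)/n$. $S$ is normal if every binary string of length $k$ occurs in $S$ with limiting frequency $2^{ -k}$ for every $k$; this is equivalent to $\dim_{FS}(S)=1$. $S$ is finite-state deep if $(\exists\alpha>0)(\forall k)(\exists k')$ (for infinitely many $n$) $D^k_{FS}(S\upharpoonright n)-D^{k'}_{FS}(S\upharpoonright n)\ge\alpha n$; finite-state shallow otherwise. -}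

module Defs where

open import Data.Nat using (ℕ; zero; suc; _+_; _*_; _^_; _≤_; _≥_; ∣_-_∣)
open import Data.Bool using (Bool; true; false; _∧_; if_then_else_)
open import Data.Fin using (Fin; toℕ)
import Data.Fin as F
open import Data.List using (List; []; _∷_; _++_; length; map; upTo; replicate; concatMap; allFin)
open import Data.Product using (Σ; ∃; ∃-syntax; _×_; _,_)
open import Relation.Binary.PropositionalEquality using (_≡_)
open import Relation.Nullary using (¬_)

-- Binary alphabet {0,1} represented by Bool (false = 0, true = 1).
Bit : Set
Bit = Bool

Seq : Set
Seq = ℕ → Bit

_↾_ : Seq → ℕ → List Bit
S ↾ n = map S (upTo n)

record FST : Set where
  field
    m  : ℕ
    δ  : Fin (suc m) → Bit → Fin (suc m)
    ν  : Fin (suc m) → Bit → List Bit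

  q₀ : Fin (suc m)
  q₀ = F.zero

  δ* : Fin (suc m) → List Bit → Fin (suc m)
  δ* q []      = q
  δ* q (a ∷ x) = δ* (δ q a) x

  δ̂ : List Bit → Fin (suc m)
  δ̂ = δ* q₀

  out : Fin (suc m) → List Bit → List Bit
  out q []      = []
  out q (a ∷ x) = ν q a ++ out (δ q a) x

  -- T(x), satisfying T(λ)=λ, T(xa) = T(x) ν(δ̂(x),a)
  run : List Bit → List Bit
  run = out q₀

  Reachable : Set
  Reachable = ∀ (q : Fin (suc m)) → ∃[ x ] (δ̂ x ≡ q)

open FST public

unary : ℕ → List Bit
unary n = replicate n true ++ (false ∷ [])

selfDelim : List Bit → List Bit
selfDelim []      = false ∷ true ∷ []
selfDelim (b ∷ w) = b ∷ b ∷ selfDelim w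

encode : FST → List Bit
encode T = unary (FST.m T) ++ concatMap entry (allFin (suc (FST.m T)))
  where
  entryBit : Fin (suc (FST.m T)) → Bit → List Bit
  entryBit q a = unary (toℕ (FST.δ T q a)) ++ selfDelim (FST.ν T q a)
  entry : Fin (suc (FST.m T)) → List Bit
  entry q = entryBit q false ++ entryBit q true

∣_∣ᶠ : FST → ℕ
∣ T ∣ᶠ = length (encode T)

InFST≤ : ℕ → FST → Set
InFST≤ k T = Reachable T × ∣ T ∣ᶠ ≤ k

Prog : ℕ → List Bit → List Bit → Set
Prog k x p = Σ FST λ T → InFST≤ k T × run T p ≡ x

D≤ : ℕ → List Bit → ℕ → Set
D≤ k x d = ∃[ p ] (Prog k x p × length p ≤ d)

D≡ : ℕ → List Bit → ℕ → Set
D≡ k x d = ∃[ p ] (Prog k x p × length p ≡ d) × (∀ p → Prog k x p → d ≤ length p)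

-- Dim_FS(S) = 0, unfolded with rational ε = 1/(e+1):
-- for every ε > 0 there is k with limsup_n D^k(S↾n)/n ≤ ε, i.e.
-- ∀ e ∃ k ∃ N ∀ n ≥ N, (e+1)·D^k(S↾n) ≤ n.
DimFSZero : Seq → Set
DimFSZero S = ∀ (e : ℕ) → ∃[ k ] ∃[ N ] ∀ n → n ≥ N →
  ∃[ d ] (D≡ k (S ↾ n) d × suc e * d ≤ n)

_≟b_ : Bit → Bit → Bool
true  ≟b true  = true
false ≟b false = true
_     ≟b _     = false

isPrefix : List Bit → List Bit → Bool
isPrefix []      _       = true
isPrefix (_ ∷ _) []      = false
isPrefix (a ∷ w) (b ∷ x) = (a ≟b b) ∧ isPrefix w x

occ : List Bit → List Bit → ℕ
occ w []      = 0
occ w (b ∷ x) = (if isPrefix w (b ∷ x) then 1 else 0) + occ w x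

-- S is normal: every w of length k occurs with limiting frequency 2^{-k}:
-- ∀ w ∀ ε = 1/(e+1) ∃ N ∀ n ≥ N, |occ(w,S↾n)/n − 2^{-|w|}| ≤ 1/(e+1),
-- i.e. (e+1)·|occ·2^{|w|} − n| ≤ n·2^{|w|}.
Normal : Seq → Set
Normal S = ∀ (w : List Bit) (e : ℕ) → ∃[ N ] ∀ n → n ≥ N →
  suc e * ∣ occ w (S ↾ n) * 2 ^ length w - n ∣ ≤ n * 2 ^ length w

-- S is finite-state deep: ∃ α = a/b > 0 ∀ k ∃ k' for infinitely many n,
-- D^k(S↾n) − D^{k'}(S↾n) ≥ α n.  (If S↾n has no k-program, D^k = ∞ and the
-- inequality holds; the universal quantification over k-programs captures this.)
FSDeep : Seq → Set
FSDeep S = ∃[ a ] ∃[ b ] (1 ≤ a × 1 ≤ b ×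
  (∀ k → ∃[ k' ] ∀ N → ∃[ n ] (n ≥ N × ∃[ d' ] (D≡ k' (S ↾ n) d' ×
     (∀ p → Prog k (S ↾ n) p → b * d' + a * n ≤ b * length p)))))

FSShallow : Seq → Set
FSShallow S = ¬ FSDeep S

-- Both parts exhibit, for every α > 0, a level k that on long prefixes S ↾ n comes within
-- αn of every level k′; then S cannot be deep.  If Dim_FS(S) = 0, take a level whose programs
-- for S ↾ n are shorter than αn.  If S is normal, take the identity transducer, since S ↾ n
-- is incompressible: cut a program p of a transducer T into ⌈|p|/L⌉ blocks of L bits.  Each
-- block is output as a word of the dictionary of T (the outputs of words of length ≤ L from
-- any state, at most s·2^(L+1) words for s states), and a block output w longer than R is
-- charged its excess |w| − R to the occurrence of w in S ↾ n where it is written.  Normality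
-- bounds the occurrences of w by 2n/2^|w|, so the excesses add up to at most
-- s·2^(L+1)·n/2^R, which is o(n) once R − L is large.  Hence n ≤ ⌈|p|/L⌉·R + o(n), that is
-- |p| ≥ (L/R)·n − o(n), with L/R as close to 1 as we like.
module Submission where

open import Defs
open import Data.Bool using (true; false)
open import Data.Fin using (Fin; toℕ)
import Data.Fin as Fin
open import Data.List using (List; []; _∷_; _++_; length; map; take; drop; concatMap; allFin; cartesianProductWith; upTo)
open import Data.List.Properties using (length-++; length-map; length-upTo; length-tabulate; length-take; length-drop; take++drop≡id; ++-assoc; length-++-≤ˡ; length-++-≤ʳ)
open import Data.List.Membership.Propositional using (_∈_)
open import Data.List.Membership.Propositional.Properties using (∈-allFin; ∈-cartesianProductWith⁺; ∈-cartesianProductWith⁻)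
open import Data.List.Relation.Unary.All using (All; []; _∷_)
import Data.List.Relation.Unary.All as All
open import Data.List.Relation.Unary.Any using (here; there)
open import Data.Nat using (ℕ; zero; suc; _+_; _*_; _^_; _∸_; _⊔_; _≤_; _<_; _≥_; z≤n; s≤s; z<s; NonZero; >-nonZero; ∣_-_∣)
open import Data.Nat.ListAction using (sum)
open import Data.Nat.DivMod using (_/_; _%_; m≡m%n+[m/n]*n; m%n<n; m/n*n≤m)
open import Data.Nat.Properties
open import Algebra.Properties.CommutativeSemigroup +-commutativeSemigroup
  using () renaming (interchange to [m+n]+[o+p]≡[m+o]+[n+p]; x∙yz≈y∙xz to m+[n+o]≡n+[m+o])
open import Algebra.Properties.CommutativeSemigroup *-commutativeSemigroup
  using () renaming (x∙yz≈y∙xz to m*[n*o]≡n*[m*o])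
open import Data.Nat.Tactic.RingSolver using (solve-∀)
open import Data.Product using (_×_; _,_; ∃-syntax; uncurry)
open import Data.Sum using (inj₁; inj₂)
open import Function using (_∘_; id)
open import Relation.Binary.PropositionalEquality using (_≡_; refl; sym; trans; cong; cong₂)

open ≤-Reasoning

Eventually : (ℕ → Set) → Set
Eventually P = ∃[ N ] ∀ n → n ≥ N → P n

eventually-mono : ∀ {P Q : ℕ → Set} → (∀ {n} → P n → Q n) → Eventually P → Eventually Q
eventually-mono f (N , p) = N , λ n n≥N → f (p n n≥N)

eventually-× : ∀ {P Q : ℕ → Set} → Eventually P → Eventually Q → Eventually (λ n → P n × Q n)
eventually-× (M , p) (N , q) =
  M ⊔ N , λ n n≥ → p n (≤-trans (m≤m⊔n M N) n≥) , q n (≤-trans (m≤n⊔m M N) n≥)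

eventually-> : ∀ C → Eventually (C <_)
eventually-> C = suc C , λ _ n>C → n>C

eventually-all : ∀ {A : Set} {P : A → ℕ → Set} → (∀ x → Eventually (P x)) →
                 ∀ xs → Eventually (λ n → All (λ x → P x n) xs)
eventually-all ev []       = 0 , λ _ _ → []
eventually-all ev (x ∷ xs) = eventually-mono (uncurry _∷_) (eventually-× (ev x) (eventually-all ev xs))

NearlyOptimal : Seq → ℕ → ℕ → ℕ → Set
NearlyOptimal S a b k = ∀ k′ → Eventually (λ n → ∀ p′ → Prog k′ (S ↾ n) p′ →
  ∃[ p ] (Prog k (S ↾ n) p × b * length p < b * length p′ + a * n))

nearly-optimal⇒shallow : ∀ {S} → (∀ a b → 1 ≤ a → 1 ≤ b → ∃[ k ] NearlyOptimal S a b k) → FSShallow S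
nearly-optimal⇒shallow near (a , b , 1≤a , 1≤b , deep) with near a b 1≤a 1≤b
... | k , ev with deep k
... | k′ , often with ev k′
... | N , beaten with often N
... | n , n≥N , _ , (p′ , (prog′ , refl) , _) , gap with beaten n n≥N p′ prog′
... | p , prog , shorter = <⇒≱ shorter (gap p prog)

length-↾ : ∀ S n → length (S ↾ n) ≡ n
length-↾ S n = trans (length-map S (upTo n)) (length-upTo n)

out-++ : ∀ T q x y → out T q (x ++ y) ≡ out T q x ++ out T (δ* T q x) y
out-++ T q []      y = refl
out-++ T q (a ∷ x) y =
  trans (cong (ν T q a ++_) (out-++ T (δ T q a) x y)) (sym (++-assoc (ν T q a) _ _))

length-out : ∀ T K → (∀ q a → length (ν T q a) ≤ K) → ∀ q x → length (out T q x) ≤ K * length x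
length-out T K ν≤K q []      = z≤n
length-out T K ν≤K q (a ∷ x) = begin
  length (ν T q a ++ out T (δ T q a) x)          ≡⟨ length-++ (ν T q a) ⟩
  length (ν T q a) + length (out T (δ T q a) x)  ≤⟨ +-mono-≤ (ν≤K q a) (length-out T K ν≤K (δ T q a) x) ⟩
  K + K * length x                               ≡⟨ *-suc K (length x) ⟨
  K * suc (length x)                             ∎

idFST : FST
idFST = record { m = 0 ; δ = λ _ _ → Fin.zero ; ν = λ _ a → a ∷ [] }

idFST-out : ∀ q x → out idFST q x ≡ x
idFST-out q []      = refl
idFST-out q (a ∷ x) = cong (a ∷_) (idFST-out Fin.zero x)

idFST-prog : ∀ x → Prog 11 x x
idFST-prog x = idFST , ((λ { Fin.zero → [] , refl }) , ≤-refl) , idFST-out Fin.zero x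

length≤length-selfDelim : ∀ w → length w ≤ length (selfDelim w)
length≤length-selfDelim []      = z≤n
length≤length-selfDelim (b ∷ w) = s≤s (m≤n⇒m≤1+n (length≤length-selfDelim w))

length-unary : ∀ n → length (unary n) ≡ suc n
length-unary zero    = refl
length-unary (suc n) = cong suc (length-unary n)

length-concatMap-∈ : ∀ {A B : Set} (f : A → List B) {x xs} → x ∈ xs → length (f x) ≤ length (concatMap f xs)
length-concatMap-∈ f {xs = y ∷ _} (here refl) = length-++-≤ˡ (f y)
length-concatMap-∈ f {xs = y ∷ _} (there x∈) = ≤-trans (length-concatMap-∈ f x∈) (length-++-≤ʳ _ {f y})

encodingEntry : (T : FST) → Fin (suc (m T)) → Bit → List Bit
encodingEntry T q a = unary (toℕ (δ T q a)) ++ selfDelim (ν T q a)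

encodingBlock : (T : FST) → Fin (suc (m T)) → List Bit
encodingBlock T q = encodingEntry T q false ++ encodingEntry T q true

states≤∣∣ᶠ : ∀ T → suc (m T) ≤ ∣ T ∣ᶠ
states≤∣∣ᶠ T = ≤-trans (≤-reflexive (sym (length-unary (m T)))) (length-++-≤ˡ (unary (m T)))

ν≤∣∣ᶠ : ∀ T q a → length (ν T q a) ≤ ∣ T ∣ᶠ
ν≤∣∣ᶠ T q a = begin
  length (ν T q a)                                ≤⟨ length≤length-selfDelim (ν T q a) ⟩
  length (selfDelim (ν T q a))                    ≤⟨ length-++-≤ʳ (selfDelim (ν T q a)) {unary (toℕ (δ T q a))} ⟩
  length (encodingEntry T q a)                    ≤⟨ entry≤block a ⟩
  length (encodingBlock T q)                      ≤⟨ length-concatMap-∈ (encodingBlock T) (∈-allFin q) ⟩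
  length (concatMap (encodingBlock T) (allFin _)) ≤⟨ length-++-≤ʳ _ {unary (m T)} ⟩
  ∣ T ∣ᶠ                                          ∎
  where
  entry≤block : ∀ a → length (encodingEntry T q a) ≤ length (encodingBlock T q)
  entry≤block false = length-++-≤ˡ (encodingEntry T q false)
  entry≤block true  = length-++-≤ʳ (encodingEntry T q true) {encodingEntry T q false}

length-cartesianProductWith : ∀ {A B C : Set} (f : A → B → C) xs ys →
  length (cartesianProductWith f xs ys) ≡ length xs * length ys
length-cartesianProductWith f []       ys = refl
length-cartesianProductWith f (x ∷ xs) ys = begin-equality
  length (map (f x) ys ++ cartesianProductWith f xs ys)           ≡⟨ length-++ (map (f x) ys) ⟩
  length (map (f x) ys) + length (cartesianProductWith f xs ys)   ≡⟨ cong₂ _+_ (length-map (f x) ys) (length-cartesianProductWith f xs ys) ⟩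
  length ys + length xs * length ys                               ∎

words≤ : ℕ → List (List Bit)
words≤ zero    = [] ∷ []
words≤ (suc n) = [] ∷ cartesianProductWith _∷_ (false ∷ true ∷ []) (words≤ n)

length≤⇒∈-words≤ : ∀ {n w} → length w ≤ n → w ∈ words≤ n
length≤⇒∈-words≤ {zero}  {[]}    _         = here refl
length≤⇒∈-words≤ {suc n} {[]}    _         = here refl
length≤⇒∈-words≤ {suc n} {a ∷ w} (s≤s w≤n) = there (∈-cartesianProductWith⁺ _∷_ (bit∈ a) (length≤⇒∈-words≤ w≤n))
  where
  bit∈ : ∀ a → a ∈ false ∷ true ∷ []
  bit∈ false = here refl
  bit∈ true  = there (here refl)

∈-words≤⇒length≤ : ∀ {n w} → w ∈ words≤ n → length w ≤ n
∈-words≤⇒length≤ {zero}  (here refl) = z≤n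
∈-words≤⇒length≤ {suc n} (here refl) = z≤n
∈-words≤⇒length≤ {suc n} (there w∈) with ∈-cartesianProductWith⁻ _∷_ (false ∷ true ∷ []) (words≤ n) w∈
... | _ , _ , _ , w∈ₙ , refl = s≤s (∈-words≤⇒length≤ w∈ₙ)

length-words≤ : ∀ n → length (words≤ n) < 2 ^ suc n
length-words≤ zero    = s≤s (s≤s z≤n)
length-words≤ (suc n) = begin-strict
  length (words≤ (suc n))   ≡⟨ cong suc (length-cartesianProductWith _∷_ (false ∷ true ∷ []) (words≤ n)) ⟩
  suc (2 * length (words≤ n)) <⟨ ≤-reflexive (sym (*-suc 2 (length (words≤ n)))) ⟩
  2 * suc (length (words≤ n)) ≤⟨ *-monoʳ-≤ 2 (length-words≤ n) ⟩
  2 ^ suc (suc n)             ∎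

dictionary : FST → ℕ → List (List Bit)
dictionary T L = cartesianProductWith (out T) (allFin (suc (m T))) (words≤ L)

out-∈-dictionary : ∀ T L q x → length x ≤ L → out T q x ∈ dictionary T L
out-∈-dictionary T L q x x≤L = ∈-cartesianProductWith⁺ (out T) {a = q} {b = x} (∈-allFin q) (length≤⇒∈-words≤ x≤L)

∈-dictionary⇒length≤ : ∀ T L K → (∀ q a → length (ν T q a) ≤ K) → ∀ {w} → w ∈ dictionary T L → length w ≤ K * L
∈-dictionary⇒length≤ T L K ν≤K w∈ with ∈-cartesianProductWith⁻ (out T) (allFin (suc (m T))) (words≤ L) w∈
... | q , x , _ , x∈ , refl = ≤-trans (length-out T K ν≤K q x) (*-monoʳ-≤ K (∈-words≤⇒length≤ x∈))

length-dictionary : ∀ T L → length (dictionary T L) ≤ suc (m T) * 2 ^ suc L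
length-dictionary T L = begin
  length (dictionary T L)                          ≡⟨ length-cartesianProductWith (out T) (allFin (suc (m T))) (words≤ L) ⟩
  length (allFin (suc (m T))) * length (words≤ L)  ≡⟨ cong (_* length (words≤ L)) (length-tabulate {n = suc (m T)} id) ⟩
  suc (m T) * length (words≤ L)                    ≤⟨ *-monoʳ-≤ (suc (m T)) (<⇒≤ (length-words≤ L)) ⟩
  suc (m T) * 2 ^ suc L                            ∎

≟b-refl : ∀ b → (b ≟b b) ≡ true
≟b-refl true  = refl
≟b-refl false = refl

isPrefix-++ : ∀ w x → isPrefix w (w ++ x) ≡ true
isPrefix-++ []      x = refl
isPrefix-++ (a ∷ w) x rewrite ≟b-refl a = isPrefix-++ w x

occ-++ : ∀ w y x → occ w x ≤ occ w (y ++ x)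
occ-++ w []      x = ≤-refl
occ-++ w (b ∷ y) x = ≤-trans (occ-++ w y x) (m≤n+m _ _)

occ-self-++ : ∀ a w x → suc (occ (a ∷ w) x) ≤ occ (a ∷ w) ((a ∷ w) ++ x)
occ-self-++ a w x rewrite isPrefix-++ (a ∷ w) x = s≤s (occ-++ (a ∷ w) w x)

excess : ℕ → List Bit → ℕ
excess R w = length w ∸ R

excessWeight : ℕ → List (List Bit) → List Bit → ℕ
excessWeight R W x = sum (map (λ w → excess R w * occ w x) W)

excessWeight-++ : ∀ R W y x → excessWeight R W x ≤ excessWeight R W (y ++ x)
excessWeight-++ R []      y x = ≤-refl
excessWeight-++ R (w ∷ W) y x = +-mono-≤ (*-monoʳ-≤ (excess R w) (occ-++ w y x)) (excessWeight-++ R W y x)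

excess-occ-self-++ : ∀ R u x → excess R u + excess R u * occ u x ≤ excess R u * occ u (u ++ x)
excess-occ-self-++ R []      x rewrite 0∸n≡0 R = z≤n
excess-occ-self-++ R (a ∷ u) x = begin
  excess R (a ∷ u) + excess R (a ∷ u) * occ (a ∷ u) x ≡⟨ *-suc (excess R (a ∷ u)) _ ⟨
  excess R (a ∷ u) * suc (occ (a ∷ u) x)              ≤⟨ *-monoʳ-≤ (excess R (a ∷ u)) (occ-self-++ a u x) ⟩
  excess R (a ∷ u) * occ (a ∷ u) ((a ∷ u) ++ x)       ∎

excessWeight-∈-++ : ∀ R W u x → u ∈ W → excess R u + excessWeight R W x ≤ excessWeight R W (u ++ x)
excessWeight-∈-++ R (u ∷ W) u x (here refl) = begin
  excess R u + (excess R u * occ u x + excessWeight R W x)  ≡⟨ +-assoc (excess R u) _ _ ⟨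
  (excess R u + excess R u * occ u x) + excessWeight R W x  ≤⟨ +-mono-≤ (excess-occ-self-++ R u x) (excessWeight-++ R W u x) ⟩
  excess R u * occ u (u ++ x) + excessWeight R W (u ++ x)   ∎
excessWeight-∈-++ R (w ∷ W) u x (there u∈W) = begin
  excess R u + (excess R w * occ w x + excessWeight R W x)  ≡⟨ m+[n+o]≡n+[m+o] (excess R u) (excess R w * occ w x) (excessWeight R W x) ⟩
  excess R w * occ w x + (excess R u + excessWeight R W x)  ≤⟨ +-mono-≤ (*-monoʳ-≤ (excess R w) (occ-++ w u x)) (excessWeight-∈-++ R W u x u∈W) ⟩
  excess R w * occ w (u ++ x) + excessWeight R W (u ++ x)   ∎

parse-bound : ∀ T L R t q p → length p ≤ t * L →
  length (out T q p) ≤ t * R + excessWeight R (dictionary T L) (out T q p)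
parse-bound T L R zero    q []      _ = z≤n
parse-bound T L R (suc t) q p p≤tL = begin
  length (out T q p)                            ≡⟨ cong (length ∘ out T q) (sym split) ⟩
  length (out T q (c ++ r))                     ≡⟨ cong length (out-++ T q c r) ⟩
  length (u ++ v)                               ≡⟨ length-++ u ⟩
  length u + length v                           ≤⟨ +-mono-≤ (m≤n+m∸n (length u) R) (parse-bound T L R t _ r r≤tL) ⟩
  (R + excess R u) + (t * R + Φ v)              ≡⟨ [m+n]+[o+p]≡[m+o]+[n+p] R (excess R u) (t * R) (Φ v) ⟩
  suc t * R + (excess R u + Φ v)                ≤⟨ +-monoʳ-≤ (suc t * R) (excessWeight-∈-++ R W u v (out-∈-dictionary T L q c c≤L)) ⟩
  suc t * R + Φ (u ++ v)                        ≡⟨ cong (λ x → suc t * R + Φ x) (out-++ T q c r) ⟨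
  suc t * R + Φ (out T q (c ++ r))              ≡⟨ cong (λ x → suc t * R + Φ (out T q x)) split ⟩
  suc t * R + Φ (out T q p)                     ∎
  where
  W = dictionary T L
  Φ = excessWeight R W
  c = take L p
  r = drop L p
  u = out T q c
  v = out T (δ* T q c) r
  split : c ++ r ≡ p
  split = take++drop≡id L p
  c≤L : length c ≤ L
  c≤L = ≤-trans (≤-reflexive (length-take L p)) (m⊓n≤m L (length p))
  r≤tL : length r ≤ t * L
  r≤tL = ≤-trans (≤-reflexive (length-drop L p)) (m≤n+o⇒m∸n≤o (length p) L p≤tL)

[1+e]∣m-n∣≤ne⇒m≤2n : ∀ m n e → suc e * ∣ m - n ∣ ≤ n * e → m ≤ 2 * n
[1+e]∣m-n∣≤ne⇒m≤2n m n e close = begin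
  m              ≤⟨ m≤n+∣m-n∣ m n ⟩
  n + ∣ m - n ∣  ≤⟨ +-monoʳ-≤ n (*-cancelˡ-≤ (suc e) (≤-trans close ne≤[1+e]n)) ⟩
  n + n          ≡⟨ cong (n +_) (+-identityʳ n) ⟨
  2 * n          ∎
  where
  ne≤[1+e]n : n * e ≤ suc e * n
  ne≤[1+e]n = ≤-trans (*-monoʳ-≤ n (n≤1+n e)) (≤-reflexive (*-comm n (suc e)))

normal⇒occ-bound : ∀ {S} → Normal S → ∀ w → Eventually (λ n → occ w (S ↾ n) * 2 ^ length w ≤ 2 * n)
normal⇒occ-bound normal w =
  eventually-mono (λ {n} → [1+e]∣m-n∣≤ne⇒m≤2n _ n _) (normal w (2 ^ length w))

n<2^n : ∀ n → n < 2 ^ n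
n<2^n zero    = z<s
n<2^n (suc n) = begin-strict
  suc n          <⟨ +-mono-≤ (m^n>0 2 n) (n<2^n n) ⟩
  2 ^ n + 2 ^ n  ≡⟨ cong (2 ^ n +_) (+-identityʳ (2 ^ n)) ⟨
  2 ^ suc n      ∎

2n≤2^n : ∀ n → 2 * n ≤ 2 ^ n
2n≤2^n zero    = z≤n
2n≤2^n (suc n) = *-monoʳ-≤ 2 (n<2^n n)

excess-occ-bound : ∀ R w o n → o * 2 ^ length w ≤ 2 * n → excess R w * o * 2 ^ R ≤ n
excess-occ-bound R w o n frequent with ≤-total (length w) R
... | inj₁ w≤R rewrite m≤n⇒m∸n≡0 w≤R = z≤n
... | inj₂ R≤w = *-cancelˡ-≤ 2 (begin
  2 * (j * o * 2 ^ R)   ≡⟨ regroup j o (2 ^ R) ⟩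
  2 * j * (o * 2 ^ R)   ≤⟨ *-monoˡ-≤ (o * 2 ^ R) (2n≤2^n j) ⟩
  2 ^ j * (o * 2 ^ R)   ≡⟨ m*[n*o]≡n*[m*o] (2 ^ j) o (2 ^ R) ⟩
  o * (2 ^ j * 2 ^ R)   ≡⟨ cong (o *_) (^-distribˡ-+-* 2 j R) ⟨
  o * 2 ^ (j + R)       ≡⟨ cong (λ ℓ → o * 2 ^ ℓ) (m∸n+n≡m R≤w) ⟩
  o * 2 ^ length w      ≤⟨ frequent ⟩
  2 * n                 ∎)
  where
  j = excess R w
  regroup : ∀ j o X → 2 * (j * o * X) ≡ 2 * j * (o * X)
  regroup = solve-∀

excessWeight-bound : ∀ R W x n → All (λ w → occ w x * 2 ^ length w ≤ 2 * n) W →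
  excessWeight R W x * 2 ^ R ≤ length W * n
excessWeight-bound R []      x n []                = z≤n
excessWeight-bound R (w ∷ W) x n (frequent ∷ rest) = begin
  (excess R w * occ w x + excessWeight R W x) * 2 ^ R        ≡⟨ *-distribʳ-+ (2 ^ R) (excess R w * occ w x) _ ⟩
  excess R w * occ w x * 2 ^ R + excessWeight R W x * 2 ^ R  ≤⟨ +-mono-≤ (excess-occ-bound R w (occ w x) n frequent)
                                                                         (excessWeight-bound R W x n rest) ⟩
  n + length W * n                                            ∎

m≤[1+m/n]*n : ∀ m n .{{_ : NonZero n}} → m ≤ suc (m / n) * n
m≤[1+m/n]*n m n = begin
  m                  ≡⟨ m≡m%n+[m/n]*n m n ⟩
  m % n + m / n * n  ≤⟨ +-monoˡ-≤ (m / n * n) (<⇒≤ (m%n<n m n)) ⟩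
  n + m / n * n      ∎

[1+m/n]*n≤m+n : ∀ m n .{{_ : NonZero n}} → suc (m / n) * n ≤ m + n
[1+m/n]*n≤m+n m n = ≤-trans (+-monoʳ-≤ n (m/n*n≤m m n)) (≤-reflexive (+-comm n m))

weight-shrinks : ∀ b s L c F n → F * 2 ^ (L + c) ≤ s * 2 ^ suc L * n → 4 * b * s ≤ 2 ^ c → 2 * b * F ≤ n
weight-shrinks b s L c F n weight states = *-cancelʳ-≤ (2 * b * F) n (2 ^ (L + c)) {{m^n≢0 2 (L + c)}} (begin
  2 * b * F * 2 ^ (L + c)          ≡⟨ *-assoc (2 * b) F (2 ^ (L + c)) ⟩
  2 * b * (F * 2 ^ (L + c))        ≤⟨ *-monoʳ-≤ (2 * b) weight ⟩
  2 * b * (s * (2 * 2 ^ L) * n)    ≡⟨ regroup b s (2 ^ L) n ⟩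
  4 * b * s * (2 ^ L * n)          ≤⟨ *-monoˡ-≤ (2 ^ L * n) states ⟩
  2 ^ c * (2 ^ L * n)              ≡⟨ m*[n*o]≡n*[m*o] (2 ^ c) (2 ^ L) n ⟩
  2 ^ L * (2 ^ c * n)              ≡⟨ *-assoc (2 ^ L) (2 ^ c) n ⟨
  2 ^ L * 2 ^ c * n                ≡⟨ cong (_* n) (^-distribˡ-+-* 2 L c) ⟨
  2 ^ (L + c) * n                  ≡⟨ *-comm (2 ^ (L + c)) n ⟩
  n * 2 ^ (L + c)                  ∎)
  where
  regroup : ∀ b s Y n → 2 * b * (s * (2 * Y) * n) ≡ 4 * b * s * (Y * n)
  regroup = solve-∀

short-program⇒short-prefix : ∀ b c t d F n →
  n ≤ t * (2 * b * c + c) + F → t * (2 * b * c) ≤ d + 2 * b * c → 2 * b * F ≤ n →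
  b * d + n ≤ b * n → n ≤ b * (2 * b + 1) * (2 * b * c)
short-program⇒short-prefix b c t d F n parse blocks small compressed =
  -- the coefficients of n differ by exactly b(2b − 1) − (2b + 1)(b − 1) = 1
  +-cancelˡ-≤ Q n C (begin
    Q + n                                                     ≡⟨ split-left b d n ⟩
    b * (2 * b * n) + (2 * b + 1) * (b * d + n)               ≤⟨ +-mono-≤ (*-monoʳ-≤ b 2bn≤) (*-monoʳ-≤ (2 * b + 1) compressed) ⟩
    b * ((2 * b + 1) * (d + 2 * b * c) + n) + (2 * b + 1) * (b * n) ≡⟨ split-right b c d n ⟩
    Q + C                                                     ∎)
  where
  blocks-to-bits : ∀ b c t F → 2 * b * (t * (2 * b * c + c) + F) ≡ (2 * b + 1) * (t * (2 * b * c)) + 2 * b * F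
  blocks-to-bits = solve-∀
  split-left : ∀ b d n → (2 * b + 1) * b * d + 2 * b * b * n + 2 * b * n + n ≡ b * (2 * b * n) + (2 * b + 1) * (b * d + n)
  split-left = solve-∀
  split-right : ∀ b c d n → b * ((2 * b + 1) * (d + 2 * b * c) + n) + (2 * b + 1) * (b * n)
                          ≡ (2 * b + 1) * b * d + 2 * b * b * n + 2 * b * n + b * (2 * b + 1) * (2 * b * c)
  split-right = solve-∀
  Q = (2 * b + 1) * b * d + 2 * b * b * n + 2 * b * n
  C = b * (2 * b + 1) * (2 * b * c)
  2bn≤ : 2 * b * n ≤ (2 * b + 1) * (d + 2 * b * c) + n
  2bn≤ = begin
    2 * b * n                                      ≤⟨ *-monoʳ-≤ (2 * b) parse ⟩
    2 * b * (t * (2 * b * c + c) + F)              ≡⟨ blocks-to-bits b c t F ⟩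
    (2 * b + 1) * (t * (2 * b * c)) + 2 * b * F    ≤⟨ +-mono-≤ (*-monoʳ-≤ (2 * b + 1) blocks) small ⟩
    (2 * b + 1) * (d + 2 * b * c) + n              ∎

normal⇒incompressible : ∀ {S} → Normal S → ∀ K b .{{_ : NonZero b}} →
  Eventually (λ n → ∀ p → Prog K (S ↾ n) p → b * n < b * length p + n)
normal⇒incompressible {S} normal K b =
  eventually-mono (uncurry incompressible)
    (eventually-× (eventually-all (normal⇒occ-bound normal) (words≤ (K * L)))
                  (eventually-> (b * (2 * b + 1) * L)))
  where
  -- L/R = 2b/(2b+1) beats the ratio 1 − 1/b of a compressing program, and 2^c exceeds 4b
  -- times the number of states of every T with ∣ T ∣ᶠ ≤ K.
  c = suc (4 * b * K)
  L = 2 * b * c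
  R = L + c
  instance
    L≢0 : NonZero L
    L≢0 = m*n≢0 (2 * b) c {{m*n≢0 2 b}}
  incompressible : ∀ {n} → All (λ w → occ w (S ↾ n) * 2 ^ length w ≤ 2 * n) (words≤ (K * L)) →
                   b * (2 * b + 1) * L < n → ∀ p → Prog K (S ↾ n) p → b * n < b * length p + n
  incompressible {n} frequent large p (T , (_ , ∣T∣≤K) , T[p]≡S↾n) = ≰⇒> λ compressed →
    <⇒≱ large (short-program⇒short-prefix b c t (length p) F n parse ([1+m/n]*n≤m+n (length p) L) small compressed)
    where
    W = dictionary T L
    F = excessWeight R W (S ↾ n)
    t = suc (length p / L)
    parse : n ≤ t * R + F
    parse = begin
      n                                      ≡⟨ length-↾ S n ⟨
      length (S ↾ n)                         ≡⟨ cong length T[p]≡S↾n ⟨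
      length (run T p)                       ≤⟨ parse-bound T L R t (q₀ T) p (m≤[1+m/n]*n (length p) L) ⟩
      t * R + excessWeight R W (run T p)     ≡⟨ cong (λ x → t * R + excessWeight R W x) T[p]≡S↾n ⟩
      t * R + F                              ∎
    ν≤K : ∀ q a → length (ν T q a) ≤ K
    ν≤K q a = ≤-trans (ν≤∣∣ᶠ T q a) ∣T∣≤K
    weight : F * 2 ^ R ≤ suc (m T) * 2 ^ suc L * n
    weight = begin
      F * 2 ^ R                    ≤⟨ excessWeight-bound R W (S ↾ n) n (All.tabulate λ w∈W →
                                        All.lookup frequent (length≤⇒∈-words≤ (∈-dictionary⇒length≤ T L K ν≤K w∈W))) ⟩
      length W * n                 ≤⟨ *-monoˡ-≤ n (length-dictionary T L) ⟩
      suc (m T) * 2 ^ suc L * n    ∎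
    states : 4 * b * suc (m T) ≤ 2 ^ c
    states = ≤-trans (*-monoʳ-≤ (4 * b) (≤-trans (states≤∣∣ᶠ T) ∣T∣≤K)) (≤-trans (n≤1+n _) (<⇒≤ (n<2^n c)))
    small : 2 * b * F ≤ n
    small = weight-shrinks b (suc (m T)) L c F n weight states

[1+b]*d≤n⇒b*d<n : ∀ b d n → suc b * d ≤ n → 0 < n → b * d < n
[1+b]*d≤n⇒b*d<n b zero    n _  n>0 rewrite *-zeroʳ b = n>0
[1+b]*d≤n⇒b*d<n b (suc d) n bd≤n _ = <-≤-trans (m<n+m (b * suc d) z<s) bd≤n

dimFSZero⇒shallow : ∀ {S} → DimFSZero S → FSShallow S
dimFSZero⇒shallow {S} dim = nearly-optimal⇒shallow near
  where
  near : ∀ a b → 1 ≤ a → 1 ≤ b → ∃[ k ] NearlyOptimal S a b k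
  near a b 1≤a _ with dim b
  ... | k , short = k , λ _ → eventually-mono beats (eventually-× short (eventually-> 0))
    where
    beats : ∀ {k′ n} → (∃[ d ] (D≡ k (S ↾ n) d × suc b * d ≤ n)) × 0 < n → ∀ p′ → Prog k′ (S ↾ n) p′ →
            ∃[ p ] (Prog k (S ↾ n) p × b * length p < b * length p′ + a * n)
    beats {n = n} ((_ , (p , (prog , refl) , _) , bd≤n) , n>0) p′ _ = p , prog , (begin-strict
      b * length p           <⟨ [1+b]*d≤n⇒b*d<n b (length p) n bd≤n n>0 ⟩
      n                      ≤⟨ m≤n*m n a {{>-nonZero 1≤a}} ⟩
      a * n                  ≤⟨ m≤n+m (a * n) (b * length p′) ⟩
      b * length p′ + a * n  ∎)

normal⇒shallow : ∀ {S} → Normal S → FSShallow S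
normal⇒shallow {S} normal = nearly-optimal⇒shallow near
  where
  near : ∀ a b → 1 ≤ a → 1 ≤ b → ∃[ k ] NearlyOptimal S a b k
  near a b 1≤a 1≤b = 11 , λ K → eventually-mono beats (normal⇒incompressible normal K b {{>-nonZero 1≤b}})
    where
    beats : ∀ {K n} → (∀ p → Prog K (S ↾ n) p → b * n < b * length p + n) → ∀ p′ → Prog K (S ↾ n) p′ →
            ∃[ p ] (Prog 11 (S ↾ n) p × b * length p < b * length p′ + a * n)
    beats {n = n} incompressible p′ prog′ = S ↾ n , idFST-prog (S ↾ n) , (begin-strict
      b * length (S ↾ n)     ≡⟨ cong (b *_) (length-↾ S n) ⟩
      b * n                  <⟨ incompressible p′ prog′ ⟩
      b * length p′ + n      ≤⟨ +-monoʳ-≤ (b * length p′) (m≤n*m n a {{>-nonZero 1≤a}}) ⟩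
      b * length p′ + a * n  ∎)

proposition1 : (S : Seq) → (DimFSZero S → FSShallow S) × (Normal S → FSShallow S)
proposition1 S = dimFSZero⇒shallow , normal⇒shallow
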